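{- Let $r\geq 2$ and $H(X,Y):=\sum_{0<j<r}\binom{r}{j}X^{r-j}Y^j\in V_r$. Then $H\in X_r\cap V_r^{(1)}$. If $r$ is odd, $H$ maps to a nonzero element of $V_r^{(1)}/V_r^{(2)}$ which spans a trivial $\mathrm{GL}_2(\mathbb{F}_2)$-subrepresentation $V_0$. If $r$ is even, then $H\in V_r^{(2)}$.
   Context: $V_r$ is the space of homogeneous polynomials of degree $r$ in $X,Y$ over $\bar{\mathbb{F}}_2$, with $\mathrm{GL}_2(\mathbb{F}_2)$ (and $\mathrm{GL}_2(\mathbb{Z}_2)$ via reduction) acting by $\begin{pmatrix}a&b\\c&d\end{pmatrix}\cdot f(X,Y)=f(aX+cY,bX+dY)$. $X_r$ is the subrepresentation generated by $X^r$. With $\theta=X^2Y-XY^2$, $V_r^{(n)}:=\theta^nV_{r-3n}$ if $r\geq 3n$ and $0$ otherwise. -}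

module Defs where

open import Level using (_⊔_)
open import Data.Nat as ℕ using (ℕ; zero; suc; _∸_; _<_; _≤_)
open import Data.Nat.Combinatorics using (_C_)
open import Data.Bool using (Bool; true; false; if_then_else_; _∧_; _xor_)
open import Data.Product using (Σ; _×_; _,_; ∃)
open import Data.Sum using (_⊎_)
open import Data.List using (List; []; _∷_)
open import Relation.Binary.PropositionalEquality using (_≡_)
open import Relation.Nullary using (¬_; does)
open import Algebra.Bundles using (CommutativeRing)

-- GL₂(F₂): 2x2 matrices (a b ; c d) over F₂ = Bool (true = 1, xor = +, ∧ = ·)
-- with nonzero determinant ad + bc.
record GL2F2 : Set where
  constructor mat
  field
    a b c d : Bool
    det≠0   : ((a ∧ d) xor (b ∧ c)) ≡ true

-- Everything below is relative to a commutative ring K (which the theorem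
-- requires to be an algebraic closure of F₂).
module Over {c ℓ} (K : CommutativeRing c ℓ) where
  open CommutativeRing K renaming (Carrier to A)

  ι : Bool → A
  ι true  = 1#
  ι false = 0#

  fromℕ : ℕ → A
  fromℕ zero    = 0#
  fromℕ (suc n) = 1# + fromℕ n

  _^_ : A → ℕ → A
  x ^ zero  = 1#
  x ^ suc n = x * (x ^ n)

  sumTo : ℕ → (ℕ → A) → A
  sumTo zero    h = h 0
  sumTo (suc n) h = sumTo n h + h (suc n)

  sumBelow : ℕ → (ℕ → A) → A
  sumBelow zero    h = 0#
  sumBelow (suc n) h = sumBelow n h + h n

  evalMonic : ℕ → (ℕ → A) → A → A
  evalMonic n cs x = (x ^ n) + sumBelow n (λ i → cs i * (x ^ i))

  record IsAlgClosureF2 : Set (c ⊔ ℓ) where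
    field
      nontrivial  : ¬ (1# ≈ 0#)
      char2       : (1# + 1#) ≈ 0#
      inverses    : ∀ x → ¬ (x ≈ 0#) → ∃ λ y → (x * y) ≈ 1#
      algClosed   : ∀ n (cs : ℕ → A) → ∃ λ x → evalMonic (suc n) cs x ≈ 0#
      algebraicF2 : ∀ x → ∃ λ n → ∃ λ (bs : ℕ → Bool) →
                      evalMonic (suc n) (λ i → ι (bs i)) x ≈ 0#

  -- Homogeneous polynomials in X, Y.
  -- A polynomial f of degree r is a coefficient sequence f : ℕ → K, where
  -- f i is the coefficient of X^(r-i) Y^i, and f i = 0 for i > r.

  Poly : Set c
  Poly = ℕ → A

  InV : ℕ → Poly → Set ℓ
  InV r f = ∀ i → r < i → f i ≈ 0#

  _≋_ : Poly → Poly → Set ℓ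
  f ≋ g = ∀ i → f i ≈ g i

  zeroP : Poly
  zeroP _ = 0#

  _⊕_ : Poly → Poly → Poly
  (f ⊕ g) i = f i + g i

  _⊖_ : Poly → Poly → Poly
  (f ⊖ g) i = f i - g i

  _·_ : A → Poly → Poly
  (s · f) i = s * f i

  -- product: X^(m-i)Y^i · X^(n-j)Y^j = X^(m+n-(i+j)) Y^(i+j)
  _⊛_ : Poly → Poly → Poly
  (f ⊛ g) k = sumTo k (λ i → f i * g (k ∸ i))

  oneP : Poly
  oneP zero    = 1#
  oneP (suc _) = 0#

  _^P_ : Poly → ℕ → Poly
  f ^P zero  = oneP
  f ^P suc n = f ⊛ (f ^P n)

  lin : A → A → Poly
  lin u v zero          = u
  lin u v (suc zero)    = v
  lin u v (suc (suc _)) = 0#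

  Xpow : Poly
  Xpow = oneP

  -- action on V_r:  (a b ; c d) · f(X,Y) = f(aX + cY, bX + dY)
  act : ℕ → GL2F2 → Poly → Poly
  act r g f k =
    sumTo r (λ i → f i * (((lin (ι (GL2F2.a g)) (ι (GL2F2.c g)) ^P (r ∸ i))
                          ⊛ (lin (ι (GL2F2.b g)) (ι (GL2F2.d g)) ^P i)) k))

  -- X_r: the subrepresentation generated by X^r, i.e. the K-span of the
  -- GL₂(F₂)-orbit of X^r.
  linComb : ℕ → List (A × GL2F2) → Poly
  linComb r []             = zeroP
  linComb r ((s , g) ∷ cs) = (s · act r g Xpow) ⊕ linComb r cs

  InXr : ℕ → Poly → Set (c ⊔ ℓ)
  InXr r f = ∃ λ (cs : List (A × GL2F2)) → f ≋ linComb r cs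

  θ : Poly
  θ zero                = 0#
  θ (suc zero)          = 1#
  θ (suc (suc zero))    = - 1#
  θ (suc (suc (suc _))) = 0#

  InVn : ℕ → ℕ → Poly → Set (c ⊔ ℓ)
  InVn r n f =
      (3 ℕ.* n ≤ r × ∃ λ h → InV (r ∸ 3 ℕ.* n) h × f ≋ ((θ ^P n) ⊛ h))
    ⊎ (r < 3 ℕ.* n × f ≋ zeroP)

  H : ℕ → Poly
  H r j = if does (0 ℕ.<? j) ∧ does (j ℕ.<? r) then fromℕ (r C j) else 0#

-- In characteristic 2, H = (X + Y)^r + X^r + Y^r is the sum of the r-th powers of the three
-- nonzero linear forms over F₂. GL₂(F₂) permutes them, so H is invariant and lies in the span of
-- the orbit of X^r. Pascal's rule gives H = θ · q with q j = C(r-1, j+1) + 1. For r = 2m, Lucas'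
-- theorem mod 2 gives H_r(X, Y) = H_m(X², Y²), and substituting squares turns θ into θ², so
-- H_r ∈ θ² V. For odd r the coefficient of X^(r-1) Y is r = 1, while it vanishes on θ² V since
-- Y² divides θ².

module Submission where

open import Defs
open import Data.Bool using (true; false; _∧_; if_then_else_)
open import Data.Bool.Properties using (∧-zeroʳ)
open import Data.Fin using (toℕ)
open import Data.List using ([]; _∷_)
open import Data.Nat as ℕ using (ℕ; zero; suc; _∸_; _≤_; _<_; z≤n; s≤s)
import Data.Nat.Properties as ℕ
open import Data.Nat.Combinatorics using (_C_; nCn≡1; nC1≡n; k>n⇒nCk≡0; nCk+nC[k+1]≡[n+1]C[k+1])
open import Data.Empty using (⊥-elim)
open import Data.Product using (_×_; _,_; ∃)
open import Data.Sum using (_⊎_; inj₁; inj₂)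
open import Function using (_∘_)
open import Relation.Binary.Definitions using (tri<; tri≈; tri>)
open import Relation.Binary.PropositionalEquality as ≡ using (_≡_; _≢_)
open import Relation.Nullary using (¬_; yes; no; does)
open import Relation.Nullary.Decidable using (dec-true; dec-false)
open import Algebra.Bundles using (CommutativeRing; CommutativeSemiring)
open import Algebra.Structures.Biased using (IsCommutativeSemiringˡ; IsCommutativeMonoidˡ)
import Algebra.Construct.Pointwise as Pointwise
import Algebra.Properties.CommutativeSemigroup as CommutativeSemigroupProperties

double : ℕ → ℕ
double zero    = zero
double (suc n) = suc (suc (double n))

double≡2* : ∀ n → double n ≡ 2 ℕ.* n
double≡2* zero    = ≡.refl
double≡2* (suc n) = ≡.cong suc (≡.trans (≡.cong suc (double≡2* n)) (≡.sym (ℕ.+-suc n (n ℕ.+ 0))))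

double-< : ∀ {m n} → m < n → double m < double n
double-< {zero}  {suc n} _         = s≤s z≤n
double-< {suc m} {suc n} (s≤s m<n) = s≤s (s≤s (double-< m<n))

double-≤ : ∀ {m n} → m ≤ n → double m ≤ double n
double-≤ {zero}  _         = z≤n
double-≤ {suc m} (s≤s m≤n) = s≤s (s≤s (double-≤ m≤n))

double-cancel-< : ∀ {m n} → double m < double n → m < n
double-cancel-< {zero}  {suc n} _               = s≤s z≤n
double-cancel-< {suc m} {suc n} (s≤s (s≤s 2m<2n)) = s≤s (double-cancel-< 2m<2n)

double-∸ : ∀ m n → double (m ∸ n) ≡ double m ∸ double n
double-∸ m       zero    = ≡.refl
double-∸ zero    (suc n) = ≡.refl
double-∸ (suc m) (suc n) = double-∸ m n

even-or-odd : ∀ k → (∃ λ j → k ≡ double j) ⊎ (∃ λ j → k ≡ suc (double j))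
even-or-odd zero = inj₁ (0 , ≡.refl)
even-or-odd (suc k) with even-or-odd k
... | inj₁ (j , ≡.refl) = inj₂ (j , ≡.refl)
... | inj₂ (j , ≡.refl) = inj₁ (suc j , ≡.refl)

module Polynomials {c ℓ} (K : CommutativeRing c ℓ) where
  open Over K
  open CommutativeRing K renaming (Carrier to A) hiding (zero)
  open import Relation.Binary.Reasoning.Setoid setoid
  open CommutativeSemigroupProperties +-commutativeSemigroup using (interchange)

  -- Finite sums

  sumTo-cong : ∀ n {f g : ℕ → A} → (∀ i → i ≤ n → f i ≈ g i) → sumTo n f ≈ sumTo n g
  sumTo-cong zero    f≈g = f≈g 0 z≤n
  sumTo-cong (suc n) f≈g =
    +-cong (sumTo-cong n (λ i i≤n → f≈g i (ℕ.m≤n⇒m≤1+n i≤n))) (f≈g (suc n) ℕ.≤-refl)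

  sumTo-+ : ∀ n (f g : ℕ → A) → sumTo n (λ i → f i + g i) ≈ sumTo n f + sumTo n g
  sumTo-+ zero    f g = refl
  sumTo-+ (suc n) f g = trans (+-congʳ (sumTo-+ n f g)) (interchange _ _ _ _)

  *-distribˡ-sumTo : ∀ n x (f : ℕ → A) → x * sumTo n f ≈ sumTo n (λ i → x * f i)
  *-distribˡ-sumTo zero    x f = refl
  *-distribˡ-sumTo (suc n) x f = trans (distribˡ x _ _) (+-congʳ (*-distribˡ-sumTo n x f))

  *-distribʳ-sumTo : ∀ n x (f : ℕ → A) → sumTo n f * x ≈ sumTo n (λ i → f i * x)
  *-distribʳ-sumTo zero    x f = refl
  *-distribʳ-sumTo (suc n) x f = trans (distribʳ x _ _) (+-congʳ (*-distribʳ-sumTo n x f))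

  sumTo-cons : ∀ n (f : ℕ → A) → sumTo (suc n) f ≈ f 0 + sumTo n (f ∘ suc)
  sumTo-cons zero    f = refl
  sumTo-cons (suc n) f = trans (+-congʳ (sumTo-cons n f)) (+-assoc _ _ _)

  sumTo-≈0 : ∀ n (f : ℕ → A) → (∀ i → i ≤ n → f i ≈ 0#) → sumTo n f ≈ 0#
  sumTo-≈0 n f f≈0 = trans (sumTo-cong n f≈0) (zeros n)
    where
      zeros : ∀ n → sumTo n (λ _ → 0#) ≈ 0#
      zeros zero    = refl
      zeros (suc n) = trans (+-congʳ (zeros n)) (+-identityʳ 0#)

  sumTo-single0 : ∀ n (f : ℕ → A) → (∀ i → f (suc i) ≈ 0#) → sumTo n f ≈ f 0
  sumTo-single0 zero    f _   = refl
  sumTo-single0 (suc n) f f≈0 = trans (+-cong (sumTo-single0 n f f≈0) (f≈0 n)) (+-identityʳ _)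

  sumTo-single : ∀ n {k} (f : ℕ → A) → k ≤ n → (∀ i → i ≢ k → f i ≈ 0#) → sumTo n f ≈ f k
  sumTo-single zero        f z≤n    _   = refl
  sumTo-single (suc n) {k} f k≤1+n f≈0 with k ℕ.≟ suc n
  ... | yes ≡.refl =
    trans (+-congʳ (sumTo-≈0 n f (λ i i≤n → f≈0 i (λ { ≡.refl → ℕ.1+n≰n i≤n }))))
          (+-identityˡ _)
  ... | no k≢1+n =
    trans (+-cong (sumTo-single n f (ℕ.≤-pred (ℕ.≤∧≢⇒< k≤1+n k≢1+n)) f≈0)
                  (f≈0 (suc n) (k≢1+n ∘ ≡.sym)))
          (+-identityʳ _)

  sumTo-reverse : ∀ n (f : ℕ → A) → sumTo n f ≈ sumTo n (λ i → f (n ∸ i))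
  sumTo-reverse zero    f = refl
  sumTo-reverse (suc n) f = begin
    sumTo n f + f (suc n)                  ≈⟨ +-congʳ (sumTo-reverse n f) ⟩
    sumTo n (λ i → f (n ∸ i)) + f (suc n)  ≈⟨ +-comm _ _ ⟩
    f (suc n) + sumTo n (λ i → f (n ∸ i))  ≈⟨ sumTo-cons n (λ i → f (suc n ∸ i)) ⟨
    sumTo (suc n) (λ i → f (suc n ∸ i))    ∎

  sumTo-triangle : ∀ n (F : ℕ → ℕ → A) →
    sumTo n (λ i → sumTo i (F i)) ≈ sumTo n (λ j → sumTo (n ∸ j) (λ m → F (j ℕ.+ m) j))
  sumTo-triangle zero    F = refl
  sumTo-triangle (suc n) F = begin
    sumTo n (λ i → sumTo i (F i)) + sumTo (suc n) (F (suc n))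
      ≈⟨ +-congʳ (sumTo-triangle n F) ⟩
    sumTo n (λ j → sumTo (n ∸ j) (G j)) + (sumTo n (F (suc n)) + F (suc n) (suc n))
      ≈⟨ +-assoc _ _ _ ⟨
    (sumTo n (λ j → sumTo (n ∸ j) (G j)) + sumTo n (F (suc n))) + F (suc n) (suc n)
      ≈⟨ +-cong (sumTo-+ n _ _) (reflexive (≡.cong (λ m → F m (suc n)) (ℕ.+-identityʳ (suc n)))) ⟨
    sumTo n (λ j → sumTo (n ∸ j) (G j) + F (suc n) j) + G (suc n) 0
      ≈⟨ +-cong (sumTo-cong n extend) (reflexive (≡.cong (λ m → sumTo m (G (suc n))) (ℕ.n∸n≡0 n))) ⟨
    sumTo n (λ j → sumTo (suc n ∸ j) (G j)) + sumTo (suc n ∸ suc n) (G (suc n)) ∎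
    where
      G : ℕ → ℕ → A
      G j m = F (j ℕ.+ m) j
      extend : ∀ j → j ≤ n → sumTo (suc n ∸ j) (G j) ≈ sumTo (n ∸ j) (G j) + F (suc n) j
      extend j j≤n rewrite ℕ.+-∸-assoc 1 j≤n = +-congˡ (reflexive (≡.cong (λ m → F m j) j+[1+n-j]≡1+n))
        where
          j+[1+n-j]≡1+n : j ℕ.+ suc (n ∸ j) ≡ suc n
          j+[1+n-j]≡1+n = ≡.trans (ℕ.+-suc j (n ∸ j)) (≡.cong suc (ℕ.m+[n∸m]≡n j≤n))

  -- The semiring of coefficient sequences

  ⊕-cong : ∀ {f f′ g g′} → f ≋ f′ → g ≋ g′ → (f ⊕ g) ≋ (f′ ⊕ g′)
  ⊕-cong f≋f′ g≋g′ n = +-cong (f≋f′ n) (g≋g′ n)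

  ⊛-cong : ∀ {f f′ g g′} → f ≋ f′ → g ≋ g′ → (f ⊛ g) ≋ (f′ ⊛ g′)
  ⊛-cong f≋f′ g≋g′ n = sumTo-cong n (λ i _ → *-cong (f≋f′ i) (g≋g′ (n ∸ i)))

  ⊛-comm : ∀ f g → (f ⊛ g) ≋ (g ⊛ f)
  ⊛-comm f g n = begin
    sumTo n (λ i → f i * g (n ∸ i))              ≈⟨ sumTo-reverse n _ ⟩
    sumTo n (λ i → f (n ∸ i) * g (n ∸ (n ∸ i)))  ≈⟨ sumTo-cong n swap ⟩
    sumTo n (λ i → g i * f (n ∸ i))              ∎
    where
      swap : ∀ i → i ≤ n → f (n ∸ i) * g (n ∸ (n ∸ i)) ≈ g i * f (n ∸ i)
      swap i i≤n = trans (*-comm _ _) (*-congʳ (reflexive (≡.cong g (ℕ.m∸[m∸n]≡n i≤n))))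

  ⊛-assoc : ∀ f g h → ((f ⊛ g) ⊛ h) ≋ (f ⊛ (g ⊛ h))
  ⊛-assoc f g h n = begin
    sumTo n (λ i → sumTo i (λ j → f j * g (i ∸ j)) * h (n ∸ i))
      ≈⟨ sumTo-cong n (λ i _ → *-distribʳ-sumTo i (h (n ∸ i)) _) ⟩
    sumTo n (λ i → sumTo i (λ j → f j * g (i ∸ j) * h (n ∸ i)))
      ≈⟨ sumTo-triangle n (λ i j → f j * g (i ∸ j) * h (n ∸ i)) ⟩
    sumTo n (λ j → sumTo (n ∸ j) (λ m → f j * g ((j ℕ.+ m) ∸ j) * h (n ∸ (j ℕ.+ m))))
      ≈⟨ sumTo-cong n (λ j _ → sumTo-cong (n ∸ j) (λ m _ → reindex j m)) ⟩
    sumTo n (λ j → sumTo (n ∸ j) (λ m → f j * (g m * h ((n ∸ j) ∸ m))))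
      ≈⟨ sumTo-cong n (λ j _ → *-distribˡ-sumTo (n ∸ j) (f j) _) ⟨
    sumTo n (λ j → f j * sumTo (n ∸ j) (λ m → g m * h ((n ∸ j) ∸ m))) ∎
    where
      reindex : ∀ j m → f j * g ((j ℕ.+ m) ∸ j) * h (n ∸ (j ℕ.+ m)) ≈ f j * (g m * h ((n ∸ j) ∸ m))
      reindex j m = trans (*-assoc _ _ _) (*-congˡ (*-cong
        (reflexive (≡.cong g (ℕ.m+n∸m≡n j m)))
        (reflexive (≡.cong h (≡.sym (ℕ.∸-+-assoc n j m))))))

  ⊛-identityˡ : ∀ f → (oneP ⊛ f) ≋ f
  ⊛-identityˡ f n = trans (sumTo-single0 n _ (λ _ → zeroˡ _)) (*-identityˡ (f n))

  ⊛-distribʳ : ∀ f g h → ((g ⊕ h) ⊛ f) ≋ ((g ⊛ f) ⊕ (h ⊛ f))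
  ⊛-distribʳ f g h n = trans (sumTo-cong n (λ i _ → distribʳ _ _ _)) (sumTo-+ n _ _)

  ⊛-zeroˡ : ∀ f → (zeroP ⊛ f) ≋ zeroP
  ⊛-zeroˡ f n = sumTo-≈0 n _ (λ i _ → zeroˡ _)

  -- Forgetting the degree (set X = 1), coefficient sequences form the power series semiring A[[Y]].
  ⊕-⊛-commutativeSemiring : CommutativeSemiring c ℓ
  ⊕-⊛-commutativeSemiring = record
    { isCommutativeSemiring = IsCommutativeSemiringˡ.isCommutativeSemiring record
      { +-isCommutativeMonoid = Pointwise.isCommutativeMonoid ℕ +-isCommutativeMonoid
      ; *-isCommutativeMonoid = IsCommutativeMonoidˡ.isCommutativeMonoid record
        { isSemigroup = record
          { isMagma = record
            { isEquivalence = Pointwise.isEquivalence ℕ isEquivalence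
            ; ∙-cong        = ⊛-cong
            }
          ; assoc = ⊛-assoc
          }
        ; identityˡ = ⊛-identityˡ
        ; comm      = ⊛-comm
        }
      ; distribʳ = ⊛-distribʳ
      ; zeroˡ    = ⊛-zeroˡ
      }
    }

  open CommutativeSemiring ⊕-⊛-commutativeSemiring public
    using ()
    renaming (refl to ≋-refl; sym to ≋-sym; trans to ≋-trans; +-comm to ⊕-comm;
              *-identityʳ to ⊛-identityʳ; zeroʳ to ⊛-zeroʳ)

  open import Algebra.Properties.CommutativeSemiring.Binomial ⊕-⊛-commutativeSemiring
    using (theorem; binomialExpansion)
  open import Algebra.Properties.Semiring.Exp (CommutativeSemiring.semiring ⊕-⊛-commutativeSemiring)
    using () renaming (_^_ to _^ˢ_)
  open import Algebra.Definitions.RawMonoid (CommutativeSemiring.+-rawMonoid ⊕-⊛-commutativeSemiring)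
    using (sum) renaming (_×_ to _×ˢ_)

  ^P-cong : ∀ m {P Q} → P ≋ Q → (P ^P m) ≋ (Q ^P m)
  ^P-cong zero    P≋Q = ≋-refl
  ^P-cong (suc m) P≋Q = ⊛-cong P≋Q (^P-cong m P≋Q)

  ^ˢ≋^P : ∀ P m → (P ^ˢ m) ≋ (P ^P m)
  ^ˢ≋^P P zero    = ≋-refl
  ^ˢ≋^P P (suc m) = ⊛-cong ≋-refl (^ˢ≋^P P m)

  fromℕ-+ : ∀ m n → fromℕ (m ℕ.+ n) ≈ fromℕ m + fromℕ n
  fromℕ-+ zero    n = sym (+-identityˡ _)
  fromℕ-+ (suc m) n = trans (+-congˡ (fromℕ-+ m n)) (sym (+-assoc _ _ _))

  ×ˢ≈fromℕ* : ∀ m P i → (m ×ˢ P) i ≈ fromℕ m * P i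
  ×ˢ≈fromℕ* zero    P i = sym (zeroˡ _)
  ×ˢ≈fromℕ* (suc m) P i = begin
    P i + (m ×ˢ P) i          ≈⟨ +-congˡ (×ˢ≈fromℕ* m P i) ⟩
    P i + fromℕ m * P i       ≈⟨ +-congʳ (*-identityˡ (P i)) ⟨
    1# * P i + fromℕ m * P i  ≈⟨ distribʳ _ _ _ ⟨
    (1# + fromℕ m) * P i      ∎

  sum≈sumTo : ∀ n (W : ℕ → Poly) i → sum {suc n} (W ∘ toℕ) i ≈ sumTo n (λ j → W j i)
  sum≈sumTo zero    W i = +-identityʳ (W 0 i)
  sum≈sumTo (suc n) W i = begin
    W 0 i + sum {suc n} (W ∘ suc ∘ toℕ) i ≈⟨ +-congˡ (sum≈sumTo n (W ∘ suc) i) ⟩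
    W 0 i + sumTo n (λ j → W (suc j) i)   ≈⟨ sumTo-cons n (λ j → W j i) ⟨
    sumTo (suc n) (λ j → W j i)           ∎

  binomials : ℕ → Poly
  binomials n i = fromℕ (n C i)

  pascal : ∀ n k → binomials (suc n) (suc k) ≈ binomials n k + binomials n (suc k)
  pascal n k = trans (reflexive (≡.cong fromℕ (≡.sym (nCk+nC[k+1]≡[n+1]C[k+1] n k))))
                     (fromℕ-+ (n C k) (n C suc k))

  substitute : ℕ → Poly → Poly → Poly → Poly
  substitute r L₁ L₂ f k = sumTo r (λ i → f i * ((L₁ ^P (r ∸ i)) ⊛ (L₂ ^P i)) k)

  binomial-theorem : ∀ n P Q → ((P ⊕ Q) ^P n) ≋ substitute n P Q (binomials n)
  binomial-theorem n P Q k = begin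
    ((P ⊕ Q) ^P n) k                  ≈⟨ ^P-cong n (⊕-comm P Q) k ⟩
    ((Q ⊕ P) ^P n) k                  ≈⟨ ^ˢ≋^P (Q ⊕ P) n k ⟨
    ((Q ⊕ P) ^ˢ n) k                  ≈⟨ theorem n Q P k ⟩
    binomialExpansion Q P n k         ≈⟨ sum≈sumTo n (λ i → (n C i) ×ˢ ((Q ^ˢ i) ⊛ (P ^ˢ (n ∸ i)))) k ⟩
    sumTo n (λ i → ((n C i) ×ˢ ((Q ^ˢ i) ⊛ (P ^ˢ (n ∸ i)))) k)
      ≈⟨ sumTo-cong n (λ i _ → trans (×ˢ≈fromℕ* (n C i) _ k) (*-congˡ (term i))) ⟩
    substitute n P Q (binomials n) k  ∎
    where
      term : ∀ i → ((Q ^ˢ i) ⊛ (P ^ˢ (n ∸ i))) k ≈ ((P ^P (n ∸ i)) ⊛ (Q ^P i)) k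
      term i = trans (⊛-comm (Q ^ˢ i) _ k) (⊛-cong (^ˢ≋^P P (n ∸ i)) (^ˢ≋^P Q i) k)

  -- Substituting linear forms

  X Y Z : Poly
  X = lin 1# 0#
  Y = lin 0# 1#
  Z = lin 1# 1#

  X⊛ : ∀ f → (X ⊛ f) ≋ f
  X⊛ f n = trans (sumTo-single0 n _ (λ { zero → zeroˡ _ ; (suc _) → zeroˡ _ })) (*-identityˡ (f n))

  X^P≋oneP : ∀ m → (X ^P m) ≋ oneP
  X^P≋oneP zero    = ≋-refl
  X^P≋oneP (suc m) = ≋-trans (X⊛ (X ^P m)) (X^P≋oneP m)

  Y⊛-suc : ∀ f n → (Y ⊛ f) (suc n) ≈ f n
  Y⊛-suc f n = begin
    sumTo (suc n) (λ i → Y i * f (suc n ∸ i))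
      ≈⟨ sumTo-cons n _ ⟩
    0# * f (suc n) + sumTo n (λ i → Y (suc i) * f (n ∸ i))
      ≈⟨ +-cong (zeroˡ _) (sumTo-single0 n _ (λ _ → zeroˡ _)) ⟩
    0# + 1# * f n
      ≈⟨ trans (+-identityˡ _) (*-identityˡ _) ⟩
    f n ∎

  Y^P-diag : ∀ i → (Y ^P i) i ≈ 1#
  Y^P-diag zero    = refl
  Y^P-diag (suc i) = trans (Y⊛-suc (Y ^P i) i) (Y^P-diag i)

  Y^P-off : ∀ i k → i ≢ k → (Y ^P i) k ≈ 0#
  Y^P-off zero    zero    0≢0 = ⊥-elim (0≢0 ≡.refl)
  Y^P-off zero    (suc k) _   = refl
  Y^P-off (suc i) zero    _   = zeroˡ _
  Y^P-off (suc i) (suc k) i≢k = trans (Y⊛-suc (Y ^P i) k) (Y^P-off i k (i≢k ∘ ≡.cong suc))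

  substitute-cong : ∀ r L₁ L₂ {f g} → f ≋ g → substitute r L₁ L₂ f ≋ substitute r L₁ L₂ g
  substitute-cong r L₁ L₂ f≋g k = sumTo-cong r (λ i _ → *-congʳ (f≋g i))

  substitute-⊕ : ∀ r L₁ L₂ f g →
    substitute r L₁ L₂ (f ⊕ g) ≋ (substitute r L₁ L₂ f ⊕ substitute r L₁ L₂ g)
  substitute-⊕ r L₁ L₂ f g k = trans (sumTo-cong r (λ i _ → distribʳ _ _ _)) (sumTo-+ r _ _)

  substitute-oneP : ∀ r L₁ L₂ → substitute r L₁ L₂ oneP ≋ (L₁ ^P r)
  substitute-oneP r L₁ L₂ k =
    trans (sumTo-single0 r _ (λ _ → zeroˡ _)) (trans (*-identityˡ _) (⊛-identityʳ (L₁ ^P r) k))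

  substitute-Y^P : ∀ r L₁ L₂ → substitute r L₁ L₂ (Y ^P r) ≋ (L₂ ^P r)
  substitute-Y^P r L₁ L₂ k = begin
    substitute r L₁ L₂ (Y ^P r) k
      ≈⟨ sumTo-single r _ ℕ.≤-refl (λ i i≢r → trans (*-congʳ (Y^P-off r i (i≢r ∘ ≡.sym))) (zeroˡ _)) ⟩
    (Y ^P r) r * ((L₁ ^P (r ∸ r)) ⊛ (L₂ ^P r)) k
      ≈⟨ trans (*-congʳ (Y^P-diag r)) (*-identityˡ _) ⟩
    ((L₁ ^P (r ∸ r)) ⊛ (L₂ ^P r)) k
      ≡⟨ ≡.cong (λ m → ((L₁ ^P m) ⊛ (L₂ ^P r)) k) (ℕ.n∸n≡0 r) ⟩
    (oneP ⊛ (L₂ ^P r)) k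
      ≈⟨ ⊛-identityˡ (L₂ ^P r) k ⟩
    (L₂ ^P r) k ∎

  substitute-X-Y : ∀ r {f} → InV r f → substitute r X Y f ≋ f
  substitute-X-Y r {f} f∈V k = begin
    substitute r X Y f k
      ≈⟨ sumTo-cong r (λ i _ → *-congˡ (⊛-cong (X^P≋oneP (r ∸ i)) (≋-refl {Y ^P i}) k)) ⟩
    sumTo r (λ i → f i * (oneP ⊛ (Y ^P i)) k)
      ≈⟨ sumTo-cong r (λ i _ → *-congˡ (⊛-identityˡ (Y ^P i) k)) ⟩
    sumTo r (λ i → f i * (Y ^P i) k)
      ≈⟨ pick ⟩
    f k ∎
    where
      pick : sumTo r (λ i → f i * (Y ^P i) k) ≈ f k
      pick with k ℕ.≤? r
      ... | yes k≤r =
        trans (sumTo-single r _ k≤r (λ i i≢k → trans (*-congˡ (Y^P-off i k i≢k)) (zeroʳ _)))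
              (trans (*-congˡ (Y^P-diag k)) (*-identityʳ _))
      ... | no k≰r =
        trans (sumTo-≈0 r _ (λ i i≤r → trans (*-congˡ (Y^P-off i k (λ { ≡.refl → k≰r i≤r }))) (zeroʳ _)))
              (sym (f∈V k (ℕ.≰⇒> k≰r)))

  H-inner : ∀ {r j} → 0 < j → j < r → H r j ≡ binomials r j
  H-inner {r} {j} 0<j j<r = ≡.cong₂ (λ a b → if a ∧ b then binomials r j else 0#)
    (dec-true (0 ℕ.<? j) 0<j) (dec-true (j ℕ.<? r) j<r)

  H-outer : ∀ {r j} → r ≤ j → H r j ≡ 0#
  H-outer {r} {j} r≤j = ≡.cong (λ b → if b then binomials r j else 0#)
    (≡.trans (≡.cong (does (0 ℕ.<? j) ∧_) (dec-false (j ℕ.<? r) (ℕ.≤⇒≯ r≤j))) (∧-zeroʳ _))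

  H∈V : ∀ r → InV r (H r)
  H∈V r j r<j = reflexive (H-outer (ℕ.<⇒≤ r<j))

  H-coeff1 : ∀ {r} → 1 < r → H r 1 ≈ fromℕ r
  H-coeff1 {r} 1<r = reflexive (≡.trans (H-inner (s≤s z≤n) 1<r) (≡.cong fromℕ (nC1≡n r)))

  InVn-cong : ∀ r n {f g} → f ≋ g → InVn r n f → InVn r n g
  InVn-cong r n f≋g (inj₁ (3n≤r , h , h∈V , f≋θⁿh)) =
    inj₁ (3n≤r , h , h∈V , ≋-trans (≋-sym f≋g) f≋θⁿh)
  InVn-cong r n f≋g (inj₂ (r<3n , f≋0)) =
    inj₂ (r<3n , ≋-trans (≋-sym f≋g) f≋0)

  zero∈Vn : ∀ r n {f} → f ≋ zeroP → InVn r n f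
  zero∈Vn r n f≋0 with 3 ℕ.* n ℕ.≤? r
  ... | yes 3n≤r = inj₁ (3n≤r , zeroP , (λ _ _ → refl) , ≋-trans f≋0 (≋-sym (⊛-zeroʳ (θ ^P n))))
  ... | no 3n≰r  = inj₂ (ℕ.≰⇒> 3n≰r , f≋0)

  ⊖-self : ∀ {f g} → f ≋ g → (f ⊖ g) ≋ zeroP
  ⊖-self f≋g k = trans (+-congʳ (f≋g k)) (-‿inverseʳ _)

  lin-⊕ : ∀ {u v u′ v′ p q} → u + u′ ≈ p → v + v′ ≈ q → (lin u v ⊕ lin u′ v′) ≋ lin p q
  lin-⊕ u+u′≈p v+v′≈q zero          = u+u′≈p
  lin-⊕ u+u′≈p v+v′≈q (suc zero)    = v+v′≈q
  lin-⊕ u+u′≈p v+v′≈q (suc (suc _)) = +-identityʳ 0#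

  1+0 : 1# + 0# ≈ 1#
  1+0 = +-identityʳ 1#

  0+1 : 0# + 1# ≈ 1#
  0+1 = +-identityˡ 1#

  X⊕Y≋Z : (X ⊕ Y) ≋ Z
  X⊕Y≋Z = lin-⊕ 1+0 0+1

  imageX imageY : GL2F2 → Poly
  imageX g = lin (ι (GL2F2.a g)) (ι (GL2F2.c g))
  imageY g = lin (ι (GL2F2.b g)) (ι (GL2F2.d g))

  act-Xpow : ∀ r g → act r g Xpow ≋ (imageX g ^P r)
  act-Xpow r g = substitute-oneP r (imageX g) (imageY g)

  powerSum : ℕ → Poly → Poly → Poly → Poly
  powerSum r P Q R = ((P ^P r) ⊕ (Q ^P r)) ⊕ (R ^P r)

  powerSum-cong : ∀ r {P P′ Q Q′ R R′} → P ≋ P′ → Q ≋ Q′ → R ≋ R′ →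
                  powerSum r P Q R ≋ powerSum r P′ Q′ R′
  powerSum-cong r P≋P′ Q≋Q′ R≋R′ =
    ⊕-cong (⊕-cong (^P-cong r P≋P′) (^P-cong r Q≋Q′)) (^P-cong r R≋R′)

  powerSum-swap₁₂ : ∀ r P Q R → powerSum r P Q R ≋ powerSum r Q P R
  powerSum-swap₁₂ r P Q R k = +-congʳ (+-comm _ _)

  powerSum-swap₂₃ : ∀ r P Q R → powerSum r P Q R ≋ powerSum r P R Q
  powerSum-swap₂₃ r P Q R k = trans (+-assoc _ _ _) (trans (+-congˡ (+-comm _ _)) (sym (+-assoc _ _ _)))

  ≋-by-parity : ∀ {f g} → (∀ j → f (double j) ≈ g (double j)) →
                (∀ j → f (suc (double j)) ≈ g (suc (double j))) → f ≋ g
  ≋-by-parity even odd k with even-or-odd k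
  ... | inj₁ (j , ≡.refl) = even j
  ... | inj₂ (j , ≡.refl) = odd j

  -- spread f = f(X², Y²).
  spread : Poly → Poly
  spread f zero          = f 0
  spread f (suc zero)    = 0#
  spread f (suc (suc n)) = spread (f ∘ suc) n

  spread-even : ∀ f j → spread f (double j) ≡ f j
  spread-even f zero    = ≡.refl
  spread-even f (suc j) = spread-even (f ∘ suc) j

  spread-odd : ∀ f j → spread f (suc (double j)) ≡ 0#
  spread-odd f zero    = ≡.refl
  spread-odd f (suc j) = spread-odd (f ∘ suc) j

  spread-cong : ∀ {f g} → f ≋ g → spread f ≋ spread g
  spread-cong f≋g zero          = f≋g 0
  spread-cong f≋g (suc zero)    = refl
  spread-cong f≋g (suc (suc n)) = spread-cong (f≋g ∘ suc) n

  spread-zeroP : spread zeroP ≋ zeroP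
  spread-zeroP zero          = refl
  spread-zeroP (suc zero)    = refl
  spread-zeroP (suc (suc n)) = spread-zeroP n

  spread∈V : ∀ {n h} → InV n h → InV (double n) (spread h)
  spread∈V {n} {h} h∈V k 2n<k with even-or-odd k
  ... | inj₁ (j , ≡.refl) = trans (reflexive (spread-even h j)) (h∈V j (double-cancel-< 2n<k))
  ... | inj₂ (j , ≡.refl) = reflexive (spread-odd h j)

  module Characteristic2 (char2 : 1# + 1# ≈ 0#) where
    open import Algebra.Properties.Group +-group using (inverseʳ-unique)

    x+x≈0 : ∀ x → x + x ≈ 0#
    x+x≈0 x = begin
      x + x            ≈⟨ +-cong (*-identityˡ x) (*-identityˡ x) ⟨
      1# * x + 1# * x  ≈⟨ distribʳ x 1# 1# ⟨
      (1# + 1#) * x    ≈⟨ *-congʳ char2 ⟩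
      0# * x           ≈⟨ zeroˡ x ⟩
      0#               ∎

    x+y≈[y+1]+[x+1] : ∀ x y → x + y ≈ (y + 1#) + (x + 1#)
    x+y≈[y+1]+[x+1] x y = begin
      x + y                  ≈⟨ +-comm x y ⟩
      y + x                  ≈⟨ +-identityʳ _ ⟨
      (y + x) + 0#           ≈⟨ +-congˡ char2 ⟨
      (y + x) + (1# + 1#)    ≈⟨ interchange y x 1# 1# ⟩
      (y + 1#) + (x + 1#)    ∎

    -1≈1 : - 1# ≈ 1#
    -1≈1 = sym (inverseʳ-unique 1# 1# char2)

    fromℕ-double : ∀ n → fromℕ (double n) ≈ 0#
    fromℕ-double zero    = refl
    fromℕ-double (suc n) = begin
      1# + (1# + fromℕ (double n))  ≈⟨ +-assoc _ _ _ ⟨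
      (1# + 1#) + fromℕ (double n)  ≈⟨ +-cong char2 (fromℕ-double n) ⟩
      0# + 0#                       ≈⟨ +-identityʳ 0# ⟩
      0#                            ∎

    fromℕ-odd : ∀ {r} → (∃ λ k → r ≡ 2 ℕ.* k ℕ.+ 1) → fromℕ r ≈ 1#
    fromℕ-odd (k , ≡.refl) = begin
      fromℕ (2 ℕ.* k ℕ.+ 1)       ≈⟨ fromℕ-+ (2 ℕ.* k) 1 ⟩
      fromℕ (2 ℕ.* k) + fromℕ 1   ≡⟨ ≡.cong (λ m → fromℕ m + fromℕ 1) (double≡2* k) ⟨
      fromℕ (double k) + fromℕ 1  ≈⟨ +-cong (fromℕ-double k) (+-identityʳ 1#) ⟩
      0# + 1#                     ≈⟨ +-identityˡ 1# ⟩
      1#                          ∎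

    H≋binomials⊕Xʳ⊕Yʳ : ∀ {r} → 0 < r → H r ≋ ((binomials r ⊕ Xpow) ⊕ (Y ^P r))
    H≋binomials⊕Xʳ⊕Yʳ {r} 0<r zero = sym (begin
      (fromℕ 1 + 1#) + (Y ^P r) 0  ≈⟨ +-cong (+-congʳ (+-identityʳ 1#)) (Y^P-off r 0 (ℕ.>⇒≢ 0<r)) ⟩
      (1# + 1#) + 0#               ≈⟨ +-identityʳ _ ⟩
      1# + 1#                      ≈⟨ char2 ⟩
      0#                           ∎)
    H≋binomials⊕Xʳ⊕Yʳ {r} 0<r (suc j) with ℕ.<-cmp (suc j) r
    ... | tri< j<r _ _ = sym (begin
      (binomials r (suc j) + 0#) + (Y ^P r) (suc j)  ≈⟨ +-congˡ (Y^P-off r (suc j) (ℕ.>⇒≢ j<r)) ⟩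
      (binomials r (suc j) + 0#) + 0#                ≈⟨ trans (+-identityʳ _) (+-identityʳ _) ⟩
      binomials r (suc j)                            ≡⟨ H-inner (s≤s z≤n) j<r ⟨
      H r (suc j)                                    ∎)
    ... | tri≈ _ ≡.refl _ = sym (begin
      (binomials r r + 0#) + (Y ^P r) r  ≈⟨ +-cong (+-identityʳ _) (Y^P-diag r) ⟩
      binomials r r + 1#                 ≡⟨ ≡.cong (λ m → fromℕ m + 1#) (nCn≡1 r) ⟩
      fromℕ 1 + 1#                       ≈⟨ +-congʳ (+-identityʳ 1#) ⟩
      1# + 1#                            ≈⟨ char2 ⟩
      0#                                 ≡⟨ H-outer {r} {r} ℕ.≤-refl ⟨
      H r r                              ∎)
    ... | tri> _ _ r<j = sym (begin
      (binomials r (suc j) + 0#) + (Y ^P r) (suc j)  ≈⟨ +-congˡ (Y^P-off r (suc j) (ℕ.<⇒≢ r<j)) ⟩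
      (binomials r (suc j) + 0#) + 0#                ≈⟨ trans (+-identityʳ _) (+-identityʳ _) ⟩
      binomials r (suc j)                            ≡⟨ ≡.cong fromℕ (k>n⇒nCk≡0 r<j) ⟩
      0#                                             ≡⟨ H-outer (ℕ.<⇒≤ r<j) ⟨
      H r (suc j)                                    ∎)

    substitute-H : ∀ {r} → 0 < r → ∀ L₁ L₂ →
                   substitute r L₁ L₂ (H r) ≋ powerSum r (L₁ ⊕ L₂) L₁ L₂
    substitute-H {r} 0<r L₁ L₂ k = begin
      substitute r L₁ L₂ (H r) k
        ≈⟨ substitute-cong r L₁ L₂ (H≋binomials⊕Xʳ⊕Yʳ 0<r) k ⟩
      substitute r L₁ L₂ ((binomials r ⊕ Xpow) ⊕ (Y ^P r)) k
        ≈⟨ trans (substitute-⊕ r L₁ L₂ _ _ k) (+-congʳ (substitute-⊕ r L₁ L₂ _ _ k)) ⟩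
      (substitute r L₁ L₂ (binomials r) k + substitute r L₁ L₂ Xpow k) + substitute r L₁ L₂ (Y ^P r) k
        ≈⟨ +-cong (+-cong (sym (binomial-theorem r L₁ L₂ k)) (substitute-oneP r L₁ L₂ k))
                  (substitute-Y^P r L₁ L₂ k) ⟩
      powerSum r (L₁ ⊕ L₂) L₁ L₂ k ∎

    H≋powerSum : ∀ {r} → 0 < r → H r ≋ powerSum r Z X Y
    H≋powerSum {r} 0<r k = begin
      H r k                       ≈⟨ substitute-X-Y r (H∈V r) k ⟨
      substitute r X Y (H r) k    ≈⟨ substitute-H 0<r X Y k ⟩
      powerSum r (X ⊕ Y) X Y k    ≈⟨ powerSum-cong r X⊕Y≋Z ≋-refl ≋-refl k ⟩
      powerSum r Z X Y k          ∎

    H∈Xr : ∀ {r} → 0 < r → InXr r (H r)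
    H∈Xr {r} 0<r = (1# , toZ) ∷ (1# , toX) ∷ (1# , toY) ∷ [] , λ k → begin
      H r k                                          ≈⟨ H≋powerSum 0<r k ⟩
      ((Z ^P r) k + (X ^P r) k) + (Y ^P r) k         ≈⟨ +-assoc _ _ _ ⟩
      (Z ^P r) k + ((X ^P r) k + (Y ^P r) k)         ≈⟨ +-congˡ (+-congˡ (+-identityʳ _)) ⟨
      (Z ^P r) k + ((X ^P r) k + ((Y ^P r) k + 0#))
        ≈⟨ +-cong (term toZ k) (+-cong (term toX k) (+-congʳ (term toY k))) ⟨
      linComb r ((1# , toZ) ∷ (1# , toX) ∷ (1# , toY) ∷ []) k ∎
      where
        toZ toX toY : GL2F2
        toZ = mat true  false true  true  ≡.refl
        toX = mat true  false false true  ≡.refl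
        toY = mat false true  true  false ≡.refl
        term : ∀ g k → 1# * act r g Xpow k ≈ (imageX g ^P r) k
        term g k = trans (*-identityˡ _) (act-Xpow r g k)

    -- The nonzero linear forms over F₂ are X, Y and Z = X + Y, and g permutes them.
    powerSum-orbit : ∀ r g → powerSum r (imageX g ⊕ imageY g) (imageX g) (imageY g) ≋ powerSum r Z X Y
    powerSum-orbit r (mat true  false false true  _) = powerSum-cong r (lin-⊕ 1+0 0+1) ≋-refl ≋-refl
    powerSum-orbit r (mat false true  true  false _) =
      ≋-trans (powerSum-cong r (lin-⊕ 0+1 1+0) ≋-refl ≋-refl) (powerSum-swap₂₃ r _ _ _)
    powerSum-orbit r (mat true  true  false true  _) =
      ≋-trans (powerSum-cong r (lin-⊕ char2 0+1) ≋-refl ≋-refl)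
              (≋-trans (powerSum-swap₁₂ r _ _ _)
                       (≋-trans (powerSum-swap₂₃ r _ _ _) (powerSum-swap₁₂ r _ _ _)))
    powerSum-orbit r (mat true  false true  true  _) =
      ≋-trans (powerSum-cong r (lin-⊕ 1+0 char2) ≋-refl ≋-refl) (powerSum-swap₁₂ r _ _ _)
    powerSum-orbit r (mat false true  true  true  _) =
      ≋-trans (powerSum-cong r (lin-⊕ 0+1 char2) ≋-refl ≋-refl)
              (≋-trans (powerSum-swap₂₃ r _ _ _) (powerSum-swap₁₂ r _ _ _))
    powerSum-orbit r (mat true  true  true  false _) =
      ≋-trans (powerSum-cong r (lin-⊕ char2 1+0) ≋-refl ≋-refl)
              (≋-trans (powerSum-swap₁₂ r _ _ _) (powerSum-swap₂₃ r _ _ _))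
    powerSum-orbit r (mat false false _     _     ())
    powerSum-orbit r (mat false true  false _     ())
    powerSum-orbit r (mat true  false _     false ())
    powerSum-orbit r (mat true  true  false false ())
    powerSum-orbit r (mat true  true  true  true  ())

    act-H≋H : ∀ {r} → 0 < r → ∀ g → act r g (H r) ≋ H r
    act-H≋H {r} 0<r g = ≋-trans (substitute-H 0<r (imageX g) (imageY g))
                                (≋-trans (powerSum-orbit r g) (≋-sym (H≋powerSum 0<r)))

    -- Divisibility by θ

    mulθ : Poly → Poly
    mulθ f zero          = 0#
    mulθ f (suc zero)    = f 0
    mulθ f (suc (suc n)) = f (suc n) + f n

    mulθ-cong : ∀ {f g} → f ≋ g → mulθ f ≋ mulθ g
    mulθ-cong f≋g zero          = refl
    mulθ-cong f≋g (suc zero)    = f≋g 0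
    mulθ-cong f≋g (suc (suc n)) = +-cong (f≋g (suc n)) (f≋g n)

    mulθ-zero : ∀ {f} → f ≋ zeroP → mulθ f ≋ zeroP
    mulθ-zero f≋0 zero          = refl
    mulθ-zero f≋0 (suc zero)    = f≋0 0
    mulθ-zero f≋0 (suc (suc n)) = trans (+-cong (f≋0 (suc n)) (f≋0 n)) (+-identityʳ 0#)

    θ⊛≋mulθ : ∀ f → (θ ⊛ f) ≋ mulθ f
    θ⊛≋mulθ f zero          = zeroˡ _
    θ⊛≋mulθ f (suc zero)    = trans (+-cong (zeroˡ _) (*-identityˡ _)) (+-identityˡ _)
    θ⊛≋mulθ f (suc (suc n)) = begin
      sumTo (suc (suc n)) term
        ≈⟨ trans (sumTo-cons (suc n) term) (+-congˡ (sumTo-cons n (term ∘ suc))) ⟩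
      term 0 + (term 1 + sumTo n (term ∘ suc ∘ suc))
        ≈⟨ +-cong (zeroˡ _) (+-cong (*-identityˡ _) (sumTo-single0 n _ (λ _ → zeroˡ _))) ⟩
      0# + (f (suc n) + - 1# * f n)
        ≈⟨ +-identityˡ _ ⟩
      f (suc n) + - 1# * f n
        ≈⟨ +-congˡ (trans (*-congʳ -1≈1) (*-identityˡ _)) ⟩
      f (suc n) + f n ∎
      where
        term : ℕ → A
        term i = θ i * f (suc (suc n) ∸ i)

    θ¹⊛≋mulθ : ∀ f → ((θ ^P 1) ⊛ f) ≋ mulθ f
    θ¹⊛≋mulθ f = ≋-trans (⊛-cong (⊛-identityʳ θ) (≋-refl {f})) (θ⊛≋mulθ f)

    θ²⊛≋mulθ² : ∀ f → ((θ ^P 2) ⊛ f) ≋ mulθ (mulθ f)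
    θ²⊛≋mulθ² f =
      ≋-trans (⊛-assoc θ (θ ^P 1) f) (≋-trans (θ⊛≋mulθ _) (mulθ-cong (θ¹⊛≋mulθ f)))

    -- H r = θ · Hquot r. As θ = X²Y + XY², dividing by θ is the recursion
    -- q (k-1) = H r k + q (k-2), solved by q j = C(r-1,j+1) + 1 thanks to Pascal's rule;
    -- this vanishes at j = r - 2, where it is truncated.
    Hquot : ℕ → Poly
    Hquot r j = if does (3 ℕ.+ j ℕ.≤? r) then binomials (r ∸ 1) (suc j) + 1# else 0#

    Hquot-inner : ∀ {r j} → 3 ℕ.+ j ≤ r → Hquot r j ≡ binomials (r ∸ 1) (suc j) + 1#
    Hquot-inner {r} {j} 3+j≤r = ≡.cong (λ b → if b then binomials (r ∸ 1) (suc j) + 1# else 0#)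
      (dec-true (3 ℕ.+ j ℕ.≤? r) 3+j≤r)

    Hquot-outer : ∀ r j → ¬ (3 ℕ.+ j ≤ r) → Hquot r j ≡ 0#
    Hquot-outer r j 3+j≰r = ≡.cong (λ b → if b then binomials (r ∸ 1) (suc j) + 1# else 0#)
      (dec-false (3 ℕ.+ j ℕ.≤? r) 3+j≰r)

    Hquot-value : ∀ n j → 2 ℕ.+ j ≤ suc n → Hquot (suc n) j ≈ binomials n (suc j) + 1#
    Hquot-value n j 2+j≤1+n with 3 ℕ.+ j ℕ.≤? suc n
    ... | yes 3+j≤1+n = reflexive (Hquot-inner 3+j≤1+n)
    ... | no 3+j≰1+n = begin
      Hquot (suc n) j            ≡⟨ Hquot-outer (suc n) j 3+j≰1+n ⟩
      0#                         ≈⟨ char2 ⟨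
      1# + 1#                    ≈⟨ +-congʳ (+-identityʳ 1#) ⟨
      fromℕ 1 + 1#               ≡⟨ ≡.cong (λ m → fromℕ m + 1#) (nCn≡1 (suc j)) ⟨
      binomials (suc j) (suc j) + 1#  ≡⟨ ≡.cong (λ m → binomials m (suc j) + 1#) n≡1+j ⟨
      binomials n (suc j) + 1#   ∎
      where
        n≡1+j : n ≡ suc j
        n≡1+j = ℕ.suc-injective (ℕ.≤-antisym (ℕ.≤-pred (ℕ.≰⇒> 3+j≰1+n)) 2+j≤1+n)

    Hquot∈V : ∀ r → InV (r ∸ 3) (Hquot r)
    Hquot∈V r j r∸3<j = reflexive (Hquot-outer r j (ℕ.<⇒≱ r∸3<j ∘ ℕ.∸-monoˡ-≤ 3))

    H≈Hquot+Hquot : ∀ {r m} → suc (suc m) < r → H r (suc (suc m)) ≈ Hquot r (suc m) + Hquot r m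
    H≈Hquot+Hquot {suc n} {m} 2+m<1+n = begin
      H (suc n) (suc (suc m))                                        ≡⟨ H-inner (s≤s z≤n) 2+m<1+n ⟩
      binomials (suc n) (suc (suc m))                                ≈⟨ pascal n (suc m) ⟩
      binomials n (suc m) + binomials n (suc (suc m))                ≈⟨ x+y≈[y+1]+[x+1] _ _ ⟩
      (binomials n (suc (suc m)) + 1#) + (binomials n (suc m) + 1#)
        ≈⟨ +-cong (Hquot-value n (suc m) 2+m<1+n) (Hquot-value n m (ℕ.<⇒≤ 2+m<1+n)) ⟨
      Hquot (suc n) (suc m) + Hquot (suc n) m                        ∎

    H≋mulθ-Hquot : ∀ r → H r ≋ mulθ (Hquot r)
    H≋mulθ-Hquot r             zero          = refl
    H≋mulθ-Hquot zero          (suc zero)    = refl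
    H≋mulθ-Hquot (suc zero)    (suc zero)    = refl
    H≋mulθ-Hquot (suc (suc n)) (suc zero)    = begin
      H (suc (suc n)) 1         ≈⟨ H-coeff1 {suc (suc n)} (s≤s (s≤s z≤n)) ⟩
      1# + fromℕ (suc n)        ≈⟨ +-comm _ _ ⟩
      fromℕ (suc n) + 1#        ≡⟨ ≡.cong (λ m → fromℕ m + 1#) (nC1≡n (suc n)) ⟨
      binomials (suc n) 1 + 1#  ≈⟨ Hquot-value (suc n) 0 (s≤s (s≤s z≤n)) ⟨
      Hquot (suc (suc n)) 0     ∎
    H≋mulθ-Hquot r (suc (suc m)) with suc (suc m) ℕ.<? r
    ... | yes 2+m<r = H≈Hquot+Hquot 2+m<r
    ... | no 2+m≮r = begin
      H r (suc (suc m))            ≡⟨ H-outer (ℕ.≮⇒≥ 2+m≮r) ⟩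
      0#                           ≈⟨ +-identityʳ 0# ⟨
      0# + 0#                      ≡⟨ ≡.cong₂ _+_ (Hquot-outer r (suc m) 3+m≰r) (Hquot-outer r m 2+m≮r) ⟨
      Hquot r (suc m) + Hquot r m  ∎
      where
        3+m≰r : ¬ (3 ℕ.+ suc m ≤ r)
        3+m≰r = 2+m≮r ∘ ℕ.<-≤-trans (s≤s (ℕ.n≤1+n _))

    H∈V⁽¹⁾ : ∀ r → InVn r 1 (H r)
    H∈V⁽¹⁾ r with 3 ℕ.≤? r
    ... | yes 3≤r =
      inj₁ (3≤r , Hquot r , Hquot∈V r , ≋-trans (H≋mulθ-Hquot r) (≋-sym (θ¹⊛≋mulθ (Hquot r))))
    ... | no 3≰r  = inj₂ (ℕ.≰⇒> 3≰r , ≋-trans (H≋mulθ-Hquot r) (mulθ-zero Hquot≋0))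
      where
        Hquot≋0 : Hquot r ≋ zeroP
        Hquot≋0 j = reflexive (Hquot-outer r j (3≰r ∘ ℕ.≤-trans (ℕ.m≤m+n 3 j)))

    V⁽²⁾-coeff1 : ∀ {r f} → InVn r 2 f → f 1 ≈ 0#
    V⁽²⁾-coeff1 (inj₁ (_ , h , _ , f≋θ²h)) = trans (f≋θ²h 1) (θ²⊛≋mulθ² h 1)
    V⁽²⁾-coeff1 (inj₂ (_ , f≋0))          = f≋0 1

    H∉V⁽²⁾ : ∀ {r} → ¬ (1# ≈ 0#) → 1 < r → fromℕ r ≈ 1# → ¬ InVn r 2 (H r)
    H∉V⁽²⁾ {r} 1≉0 1<r r≈1 H∈V⁽²⁾ = 1≉0 (begin
      1#       ≈⟨ trans (H-coeff1 1<r) r≈1 ⟨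
      H r 1    ≈⟨ V⁽²⁾-coeff1 H∈V⁽²⁾ ⟩
      0#       ∎)

    pascal² : ∀ n k → binomials (suc (suc n)) (suc (suc k)) ≈ binomials n k + binomials n (suc (suc k))
    pascal² n k = begin
      binomials (suc (suc n)) (suc (suc k))                        ≈⟨ pascal (suc n) (suc k) ⟩
      binomials (suc n) (suc k) + binomials (suc n) (suc (suc k))  ≈⟨ +-cong (pascal n k) (pascal n (suc k)) ⟩
      (a + b) + (b + d)                                            ≈⟨ +-assoc a b (b + d) ⟩
      a + (b + (b + d))                                            ≈⟨ +-congˡ (+-assoc b b d) ⟨
      a + ((b + b) + d)                                            ≈⟨ +-congˡ (trans (+-congʳ (x+x≈0 b)) (+-identityˡ d)) ⟩
      a + d                                                        ∎
      where
        a = binomials n k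
        b = binomials n (suc k)
        d = binomials n (suc (suc k))

    lucas-even : ∀ m i → binomials (double m) (double i) ≈ binomials m i
    lucas-even zero    zero    = refl
    lucas-even zero    (suc i) = refl
    lucas-even (suc m) zero    = refl
    lucas-even (suc m) (suc i) = begin
      binomials (double (suc m)) (double (suc i))
        ≈⟨ pascal² (double m) (double i) ⟩
      binomials (double m) (double i) + binomials (double m) (double (suc i))
        ≈⟨ +-cong (lucas-even m i) (lucas-even m (suc i)) ⟩
      binomials m i + binomials m (suc i)
        ≈⟨ pascal m i ⟨
      binomials (suc m) (suc i) ∎

    lucas-odd : ∀ m i → binomials (double m) (suc (double i)) ≈ 0#
    lucas-odd zero    i       = refl
    lucas-odd (suc m) zero    =
      trans (reflexive (≡.cong fromℕ (nC1≡n (double (suc m))))) (fromℕ-double (suc m))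
    lucas-odd (suc m) (suc i) = begin
      binomials (double (suc m)) (suc (double (suc i)))         ≈⟨ pascal² (double m) (suc (double i)) ⟩
      binomials (double m) (suc (double i)) + binomials (double m) (suc (double (suc i)))
                                                                ≈⟨ +-cong (lucas-odd m i) (lucas-odd m (suc i)) ⟩
      0# + 0#                                                   ≈⟨ +-identityʳ 0# ⟩
      0#                                                        ∎

    H-double-even : ∀ m i → H (double m) (double i) ≈ H m i
    H-double-even m zero    = refl
    H-double-even m (suc i) with suc i ℕ.<? m
    ... | yes 1+i<m = begin
      H (double m) (double (suc i))          ≡⟨ H-inner (s≤s z≤n) (double-< 1+i<m) ⟩
      binomials (double m) (double (suc i))  ≈⟨ lucas-even m (suc i) ⟩
      binomials m (suc i)                    ≡⟨ H-inner (s≤s z≤n) 1+i<m ⟨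
      H m (suc i)                            ∎
    ... | no 1+i≮m =
      reflexive (≡.trans (H-outer (double-≤ (ℕ.≮⇒≥ 1+i≮m))) (≡.sym (H-outer (ℕ.≮⇒≥ 1+i≮m))))

    H-double-odd : ∀ m i → H (double m) (suc (double i)) ≈ 0#
    H-double-odd m i with suc (double i) ℕ.<? double m
    ... | yes 1+2i<2m = trans (reflexive (H-inner (s≤s z≤n) 1+2i<2m)) (lucas-odd m i)
    ... | no 1+2i≮2m  = reflexive (H-outer (ℕ.≮⇒≥ 1+2i≮2m))

    mulθ²-spread-even : ∀ f i → mulθ (mulθ (spread f)) (double i) ≈ mulθ f i
    mulθ²-spread-even f zero          = refl
    mulθ²-spread-even f (suc zero)    = +-identityʳ _
    mulθ²-spread-even f (suc (suc i)) = begin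
      (s (suc (suc n)) + s (suc n)) + (s (suc n) + s n)
        ≡⟨ ≡.cong₂ _+_ (≡.cong₂ _+_ (spread-even (f ∘ suc) i) (spread-odd f i))
                       (≡.cong₂ _+_ (spread-odd f i) (spread-even f i)) ⟩
      (f (suc i) + 0#) + (0# + f i)   ≈⟨ +-cong (+-identityʳ _) (+-identityˡ _) ⟩
      f (suc i) + f i                 ∎
      where
        s = spread f
        n = double i

    mulθ²-spread-odd : ∀ f i → mulθ (mulθ (spread f)) (suc (double i)) ≈ 0#
    mulθ²-spread-odd f zero          = refl
    mulθ²-spread-odd f (suc zero)    = trans (+-congʳ (+-identityˡ _)) (x+x≈0 _)
    mulθ²-spread-odd f (suc (suc i)) = begin
      (s (suc (suc (suc n))) + s (suc (suc n))) + (s (suc (suc n)) + s (suc n))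
        ≡⟨ ≡.cong₂ _+_ (≡.cong (_+ s (suc (suc n))) (spread-odd (f ∘ suc) i))
                       (≡.cong (s (suc (suc n)) +_) (spread-odd f i)) ⟩
      (0# + s (suc (suc n))) + (s (suc (suc n)) + 0#)  ≈⟨ +-cong (+-identityˡ _) (+-identityʳ _) ⟩
      s (suc (suc n)) + s (suc (suc n))                ≈⟨ x+x≈0 _ ⟩
      0#                                               ∎
      where
        s = spread f
        n = double i

    spread-mulθ : ∀ f → spread (mulθ f) ≋ mulθ (mulθ (spread f))
    spread-mulθ f = ≋-by-parity
      (λ j → trans (reflexive (spread-even (mulθ f) j)) (sym (mulθ²-spread-even f j)))
      (λ j → trans (reflexive (spread-odd (mulθ f) j)) (sym (mulθ²-spread-odd f j)))

    spread-V⁽¹⁾ : ∀ m {f} → InVn m 1 f → InVn (double m) 2 (spread f)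
    spread-V⁽¹⁾ m (inj₁ (3≤m , h , h∈V , f≋θh)) =
      inj₁ (double-≤ 3≤m , spread h , spread-h∈V , spread-f≋θ²spread-h)
      where
        spread-h∈V : InV (double m ∸ 6) (spread h)
        spread-h∈V = ≡.subst (λ n → InV n (spread h)) (double-∸ m 3) (spread∈V h∈V)
        spread-f≋θ²spread-h : spread _ ≋ ((θ ^P 2) ⊛ spread h)
        spread-f≋θ²spread-h = ≋-trans (spread-cong (≋-trans f≋θh (θ¹⊛≋mulθ h)))
                                      (≋-trans (spread-mulθ h) (≋-sym (θ²⊛≋mulθ² (spread h))))
    spread-V⁽¹⁾ m (inj₂ (m<3 , f≋0)) = inj₂ (double-< m<3 , ≋-trans (spread-cong f≋0) spread-zeroP)

    H-double≋spread : ∀ m → H (double m) ≋ spread (H m)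
    H-double≋spread m = ≋-by-parity
      (λ j → trans (H-double-even m j) (sym (reflexive (spread-even (H m) j))))
      (λ j → trans (H-double-odd m j) (sym (reflexive (spread-odd (H m) j))))

    H∈V⁽²⁾-even : ∀ {r} → (∃ λ m → r ≡ 2 ℕ.* m) → InVn r 2 (H r)
    H∈V⁽²⁾-even (m , ≡.refl) = ≡.subst (λ r → InVn r 2 (H r)) (double≡2* m)
      (InVn-cong (double m) 2 (≋-sym (H-double≋spread m)) (spread-V⁽¹⁾ m (H∈V⁽¹⁾ m)))

open import Data.Nat using (_+_; _*_)

lemma4p1 : ∀ {c ℓ} (K : CommutativeRing c ℓ) → Over.IsAlgClosureF2 K →
    ∀ (r : ℕ) → 2 ≤ r →
    let open Over K in
      (InXr r (H r) × InVn r 1 (H r))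
    × ((∃ λ k → r ≡ 2 * k + 1) →
         ¬ InVn r 2 (H r)
       × (∀ (g : GL2F2) → InVn r 2 (act r g (H r) ⊖ H r)))
    × ((∃ λ k → r ≡ 2 * k) → InVn r 2 (H r))
lemma4p1 K alg r 2≤r =
    (H∈Xr 0<r , H∈V⁽¹⁾ r)
  , (λ r-odd → H∉V⁽²⁾ nontrivial 2≤r (fromℕ-odd r-odd)
              , λ g → zero∈Vn r 2 (⊖-self (act-H≋H 0<r g)))
  , H∈V⁽²⁾-even
  where
    open Over.IsAlgClosureF2 alg using (nontrivial; char2)
    open Polynomials K
    open Characteristic2 char2
    0<r : 0 < r
    0<r = ℕ.≤-trans (s≤s z≤n) 2≤r
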